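{- Let $H \subseteq F^7$ be the binary Hamming code of length 7 spanned by the vectors with supports $\{1,2,3\}$, $\{1,4,5\}$, $\{1,6,7\}$, $\{2,4,6\}$. Let $\lambda_1 : H \to\{0,1\}$ be $0$ exactly on the codewords with supports $\emptyset$, $\{1,6,7\}$, $\{1,3,5,7\}$, $\{1,\dots,7\}$ and $1$ on all other codewords of $H$; let $\lambda_2 : H\to\{0,1\}$ be $0$ exactly on the codewords with supports $\emptyset$, $\{1,6,7\}$, $\{2,4,6\}$, $\{4,5,6,7\}$ and $1$ elsewhere. Then the Vasil'ev codes $V_H^{\lambda_1}$ (denoted $V22^1$) and $V_H^{\lambda_2}$ (denoted $V3^11$) of length 15 are homogeneous.
   Context: For $\lambda: H\to\{0,1\}$ with $\lambda(0)=0$, $V_H^\lambda = \{(x+y, |x|+\lambda(y), x) : x\in F^7, y\in H\}\subseteq F^{15}$, where $|x|=x_1+\dots+x_7 \bmod 2$. For a code $D$ and $w\in D$, $\mathrm{STS}(D,w) = \{\mathrm{supp}(v+w) : v\in D, d(v,w)=3\}$; $D\subseteq F^m$ is homogeneous if for every $w \in D$ there is $\pi\in S_m$ with $\pi(\mathrm{STS}(D,w)) = \mathrm{STS}(D,0^m)$. -}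

module Defs where

open import Data.Bool using (Bool; true; false; _xor_; not; _∧_; _∨_; if_then_else_)
open import Data.Nat using (ℕ; zero; suc; _+_)
open import Data.Vec using (Vec; []; _∷_; _++_; zipWith; replicate; lookup; tabulate)
open import Data.Fin using (Fin)
open import Data.Fin.Subset using (Subset; ∣_∣)
open import Data.Fin.Permutation using (Permutation′; _⟨$⟩ˡ_)
open import Data.Product using (Σ; _×_; ∃; ∃-syntax; _,_)
open import Function.Bundles using (_⇔_)
open import Relation.Binary.PropositionalEquality using (_≡_)

F : ℕ → Set
F n = Vec Bool n

Code : ℕ → Set₁
Code n = F n → Set

0ᵛ : (n : ℕ) → F n
0ᵛ n = replicate n false

infixl 6 _⊕_
_⊕_ : ∀ {n} → F n → F n → F n
_⊕_ = zipWith _xor_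

_·_ : ∀ {n} → Bool → F n → F n
c · v = zipWith _∧_ (replicate _ c) v

supp : ∀ {n} → F n → Subset n
supp v = v

wt : ∀ {n} → F n → ℕ
wt v = ∣ supp v ∣

dist : ∀ {n} → F n → F n → ℕ
dist v w = wt (v ⊕ w)

parity : ∀ {n} → F n → Bool
parity [] = false
parity (b ∷ v) = b xor parity v

eqᵇ : ∀ {n} → F n → F n → Bool
eqᵇ [] [] = true
eqᵇ (a ∷ u) (b ∷ v) = not (a xor b) ∧ eqᵇ u v

Vasilev : ∀ {n} → Code n → (F n → Bool) → Code (n + suc n)
Vasilev {n} H λf v =
  ∃[ x ] ∃[ y ] (H y × (v ≡ (x ⊕ y) ++ ((parity x xor λf y) ∷ x)))

STS : ∀ {m} → Code m → F m → Subset m → Set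
STS D w S = ∃[ v ] (D v × dist v w ≡ 3 × S ≡ supp (v ⊕ w))

-- image of a subset under a permutation π of the positions: π(S) = {π(i) : i ∈ S}
permSubset : ∀ {m} → Permutation′ m → Subset m → Subset m
permSubset π S = tabulate (λ j → lookup S (π ⟨$⟩ˡ j))

imageFamily : ∀ {m} → Permutation′ m → (Subset m → Set) → Subset m → Set
imageFamily π 𝓕 T = ∃[ S ] (𝓕 S × permSubset π S ≡ T)

Homogeneous : ∀ {m} → Code m → Set
Homogeneous {m} D =
  ∀ w → D w → Σ (Permutation′ m) λ π → ∀ T → (imageFamily π (STS D w) T ⇔ STS D (0ᵛ m) T)

-- The specific data of the theorem (positions 1..7 written left to right)

g₁ g₂ g₃ g₄ : F 7
g₁ = true  ∷ true  ∷ true  ∷ false ∷ false ∷ false ∷ false ∷ []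
g₂ = true  ∷ false ∷ false ∷ true  ∷ true  ∷ false ∷ false ∷ []
g₃ = true  ∷ false ∷ false ∷ false ∷ false ∷ true  ∷ true  ∷ []
g₄ = false ∷ true  ∷ false ∷ true  ∷ false ∷ true  ∷ false ∷ []

Hamming : Code 7
Hamming y = ∃[ c₁ ] ∃[ c₂ ] ∃[ c₃ ] ∃[ c₄ ]
  (y ≡ (c₁ · g₁) ⊕ (c₂ · g₂) ⊕ (c₃ · g₃) ⊕ (c₄ · g₄))

s∅ s167 s1357 s1234567 s246 s4567 : F 7
s∅       = false ∷ false ∷ false ∷ false ∷ false ∷ false ∷ false ∷ []
s167     = true  ∷ false ∷ false ∷ false ∷ false ∷ true  ∷ true  ∷ []
s1357    = true  ∷ false ∷ true  ∷ false ∷ true  ∷ false ∷ true  ∷ []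
s1234567 = true  ∷ true  ∷ true  ∷ true  ∷ true  ∷ true  ∷ true  ∷ []
s246     = false ∷ true  ∷ false ∷ true  ∷ false ∷ true  ∷ false ∷ []
s4567    = false ∷ false ∷ false ∷ true  ∷ true  ∷ true  ∷ true  ∷ []

λ₁ : F 7 → Bool
λ₁ y = not (eqᵇ y s∅ ∨ eqᵇ y s167 ∨ eqᵇ y s1357 ∨ eqᵇ y s1234567)

λ₂ : F 7 → Bool
λ₂ y = not (eqᵇ y s∅ ∨ eqᵇ y s167 ∨ eqᵇ y s246 ∨ eqᵇ y s4567)

V22¹ V3¹¹ : Code 15
V22¹ = Vasilev Hamming λ₁
V3¹¹ = Vasilev Hamming λ₂

module Submission where

-- Translation by (z, |z|, z) preserves every Vasil'ev code, and
-- STS(D, w + t) = STS(D, w) whenever translation by t preserves D.  Since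
-- (x+y, |x|+λ(y), x) = (y, λ(y), 0) + (x, |x|, x), it suffices to align the
-- triple systems at the 16 coset leaders (y, λ(y), 0), y ∈ H
-- (Vasilev-homogeneous).
--
-- Certificates.  π carries a family 𝓕 onto 𝓖 as soon as π maps 𝓕 into 𝓖 and
-- π⁻¹ maps 𝓖 into 𝓕 (imageFamily-onto).  For a code with a boolean membership
-- test both inclusions, and the fact that a table of values is a permutation,
-- become boolean checks; as STS(D,w) consists of 3-subsets only the 455
-- three-element subsets of the coordinates are inspected (certificate-sound).
--
-- The theorem.  For each code a table of π is listed for every leader, and
-- one evaluation of the checks confirms all 16 certificates
-- (homogeneous-by-tables).

open import Defs
open import Algebra.Bundles using (CommutativeRing)
open import Data.Bool using (Bool; true; false; _xor_; not; _∧_; _∨_; if_then_else_; T)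
open import Data.Bool.Properties
  using (xor-∧-commutativeRing; xor-assoc; xor-comm; xor-same; xor-identityʳ; T-∧)
open import Data.Nat using (ℕ; zero; suc; _+_; _≡ᵇ_)
open import Data.Nat.Properties using (suc-injective; ≡ᵇ⇒≡; ≡⇒≡ᵇ)
open import Data.Fin using (Fin; zero; suc; #_)
open import Data.Fin.Properties using (all?) renaming (_≟_ to _≟ᶠ_)
open import Data.Fin.Permutation
  using (Permutation′; permutation; _⟨$⟩ʳ_; _⟨$⟩ˡ_; flip; inverseʳ)
open import Data.Fin.Subset using (Subset)
open import Data.Product using (Σ; _×_; _,_; proj₁; proj₂)
open import Data.Product.Function.NonDependent.Propositional using (_×-⇔_)
open import Data.Vec using (Vec; []; _∷_; _++_; lookup; tabulate; take; drop; tail)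
open import Data.Vec.Properties
  using ( zipWith-assoc; zipWith-comm; zipWith-identityʳ; zipWith-++
        ; take++drop≡id; ++-injective; lookup∘tabulate; tabulate∘lookup; tabulate-cong)
open import Function using (_∘_)
open import Function.Bundles using (_⇔_; mk⇔; module Equivalence)
open import Function.Properties.Equivalence using () renaming (trans to ⇔-trans; sym to ⇔-sym)
open import Relation.Binary.PropositionalEquality
open import Relation.Nullary.Decidable using (Dec; _×-dec_; ⌊_⌋; toWitness)
open import Algebra.Properties.CommutativeSemigroup
  (CommutativeRing.+-commutativeSemigroup xor-∧-commutativeRing)
  using (interchange; xy∙z≈xz∙y)

open ≡-Reasoning
open Equivalence using (to; from)

⊕-assoc : ∀ {n} (u v w : F n) → (u ⊕ v) ⊕ w ≡ u ⊕ (v ⊕ w)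
⊕-assoc = zipWith-assoc xor-assoc

⊕-comm : ∀ {n} (u v : F n) → u ⊕ v ≡ v ⊕ u
⊕-comm = zipWith-comm xor-comm

⊕-identityʳ : ∀ {n} (u : F n) → u ⊕ 0ᵛ n ≡ u
⊕-identityʳ = zipWith-identityʳ xor-identityʳ

⊕-self : ∀ {n} (u : F n) → u ⊕ u ≡ 0ᵛ n
⊕-self []      = refl
⊕-self (a ∷ u) = cong₂ _∷_ (xor-same a) (⊕-self u)

⊕-cancelʳ : ∀ {n} (u v : F n) → (u ⊕ v) ⊕ v ≡ u
⊕-cancelʳ u v = begin
  (u ⊕ v) ⊕ v  ≡⟨ ⊕-assoc u v v ⟩
  u ⊕ (v ⊕ v)  ≡⟨ cong (u ⊕_) (⊕-self v) ⟩
  u ⊕ 0ᵛ _     ≡⟨ ⊕-identityʳ u ⟩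
  u            ∎

⊕-swap : ∀ {n} (u v w : F n) → (u ⊕ v) ⊕ w ≡ (u ⊕ w) ⊕ v
⊕-swap u v w = begin
  (u ⊕ v) ⊕ w  ≡⟨ ⊕-assoc u v w ⟩
  u ⊕ (v ⊕ w)  ≡⟨ cong (u ⊕_) (⊕-comm v w) ⟩
  u ⊕ (w ⊕ v)  ≡⟨ ⊕-assoc u w v ⟨
  (u ⊕ w) ⊕ v  ∎

parity-⊕ : ∀ {n} (u v : F n) → parity (u ⊕ v) ≡ parity u xor parity v
parity-⊕ []      []      = refl
parity-⊕ (a ∷ u) (b ∷ v) = begin
  (a xor b) xor parity (u ⊕ v)           ≡⟨ cong ((a xor b) xor_) (parity-⊕ u v) ⟩
  (a xor b) xor (parity u xor parity v)  ≡⟨ interchange a b (parity u) (parity v) ⟩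
  (a xor parity u) xor (b xor parity v)  ∎

split-++ : ∀ {A : Set} {m n} (xs : Vec A m) (ys : Vec A n) →
           take m (xs ++ ys) ≡ xs × drop m (xs ++ ys) ≡ ys
split-++ {m = m} xs ys = ++-injective (take m (xs ++ ys)) xs (take++drop≡id m (xs ++ ys))

eqᵇ-sound : ∀ {n} (u v : F n) → T (eqᵇ u v) → u ≡ v
eqᵇ-sound []          []          _ = refl
eqᵇ-sound (true ∷ u)  (true ∷ v)  t = cong (true ∷_) (eqᵇ-sound u v t)
eqᵇ-sound (false ∷ u) (false ∷ v) t = cong (false ∷_) (eqᵇ-sound u v t)

eqᵇ-refl : ∀ {n} (u : F n) → T (eqᵇ u u)
eqᵇ-refl []          = _
eqᵇ-refl (true ∷ u)  = eqᵇ-refl u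
eqᵇ-refl (false ∷ u) = eqᵇ-refl u

T-⇒ : ∀ {a b} → T (not a ∨ b) → T a → T b
T-⇒ {true} t _ = t

T-∧-elim : ∀ a {b} → T (a ∧ b) → T a × T b
T-∧-elim true t = _ , t

allBool : (Bool → Bool) → Bool
allBool q = q true ∧ q false

allBool-sound : ∀ q → T (allBool q) → ∀ b → T (q b)
allBool-sound q t true  = proj₁ (T-∧-elim (q true) t)
allBool-sound q t false = proj₂ (T-∧-elim (q true) t)

allBool⁴ : (Bool → Bool → Bool → Bool → Bool) → Bool
allBool⁴ p = allBool λ c₁ → allBool λ c₂ → allBool λ c₃ → allBool λ c₄ → p c₁ c₂ c₃ c₄

allBool⁴-sound : ∀ p → T (allBool⁴ p) → ∀ c₁ c₂ c₃ c₄ → T (p c₁ c₂ c₃ c₄)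
allBool⁴-sound p t c₁ c₂ c₃ c₄ =
  allBool-sound (p c₁ c₂ c₃) (allBool-sound (λ c₃ → allBool (p c₁ c₂ c₃))
    (allBool-sound (λ c₂ → allBool λ c₃ → allBool (p c₁ c₂ c₃))
      (allBool-sound (λ c₁ → allBool λ c₂ → allBool λ c₃ → allBool (p c₁ c₂ c₃)) t c₁) c₂) c₃) c₄

allOfWeight : ∀ n → ℕ → (Subset n → Bool) → Bool
allOfWeight zero    zero    p = p []
allOfWeight zero    (suc k) p = true
allOfWeight (suc n) zero    p = allOfWeight n zero (p ∘ (false ∷_))
allOfWeight (suc n) (suc k) p = allOfWeight n k (p ∘ (true ∷_)) ∧ allOfWeight n (suc k) (p ∘ (false ∷_))

allOfWeight-sound : ∀ n k {p} → T (allOfWeight n k p) → ∀ S → wt S ≡ k → T (p S)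
allOfWeight-sound zero    zero        t []          refl = t
allOfWeight-sound (suc n) zero        t (false ∷ S) w    = allOfWeight-sound n zero t S w
allOfWeight-sound (suc n) (suc k)     t (true ∷ S)  w    =
  allOfWeight-sound n k (proj₁ (T-∧-elim _ t)) S (suc-injective w)
allOfWeight-sound (suc n) (suc k) {p} t (false ∷ S) w    =
  allOfWeight-sound n (suc k) (proj₂ (T-∧-elim (allOfWeight n k (p ∘ (true ∷_))) t)) S w

Decides : ∀ {m} → Code m → (F m → Bool) → Set
Decides D d = ∀ v → T (d v) ⇔ D v

module _ {m} (D : Code m) where

  STS-char : ∀ w S → STS D w S ⇔ (wt S ≡ 3 × D (S ⊕ w))
  STS-char w S = mk⇔
    (λ { (v , v∈D , d≡3 , refl) → d≡3 , subst D (sym (⊕-cancelʳ v w)) v∈D })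
    (λ (wt≡3 , S+w∈D) → S ⊕ w , S+w∈D , trans (cong wt (⊕-cancelʳ S w)) wt≡3
                                     , sym (⊕-cancelʳ S w))

  STS-translate : ∀ t → (∀ v → D v → D (v ⊕ t)) → ∀ w S → STS D (w ⊕ t) S ⇔ STS D w S
  STS-translate t closed w S =
    ⇔-trans (STS-char (w ⊕ t) S) (⇔-trans translated (⇔-sym (STS-char w S)))
    where
      translated : (wt S ≡ 3 × D (S ⊕ (w ⊕ t))) ⇔ (wt S ≡ 3 × D (S ⊕ w))
      translated = mk⇔
        (λ (k , d) → k , subst D (⊕-cancelʳ (S ⊕ w) t)
                                 (closed _ (subst D (sym (⊕-assoc S w t)) d)))
        (λ (k , d) → k , subst D (⊕-assoc S w t) (closed _ d))

module _ {m} {D : Code m} {d : F m → Bool} (d-decides : Decides D d) where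

  stsᵇ : F m → Subset m → Bool
  stsᵇ w S = (wt S ≡ᵇ 3) ∧ d (S ⊕ w)

  sts-decides : ∀ w → Decides (STS D w) (stsᵇ w)
  sts-decides w S =
    ⇔-trans T-∧ (⇔-trans (mk⇔ (≡ᵇ⇒≡ _ 3) (≡⇒≡ᵇ _ 3) ×-⇔ d-decides (S ⊕ w))
                         (⇔-sym (STS-char D w S)))

  allSTS : F m → (Subset m → Bool) → Bool
  allSTS w q = allOfWeight m 3 (λ S → not (stsᵇ w S) ∨ q S)

  allSTS-sound : ∀ w q → T (allSTS w q) → ∀ S → STS D w S → T (q S)
  allSTS-sound w q t S S∈STS =
    T-⇒ (allOfWeight-sound m 3 {λ S → not (stsᵇ w S) ∨ q S} t S wt≡3)
        (from (sts-decides w S) S∈STS)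
    where
      wt≡3 : wt S ≡ 3
      wt≡3 = proj₁ (to (STS-char D w S) S∈STS)

module _ {m} (π : Permutation′ m) where

  permSubset-flip : ∀ T → permSubset π (permSubset (flip π) T) ≡ T
  permSubset-flip T = begin
    tabulate (λ j → lookup (tabulate (λ i → lookup T (π ⟨$⟩ʳ i))) (π ⟨$⟩ˡ j))
      ≡⟨ tabulate-cong (λ j → trans (lookup∘tabulate _ (π ⟨$⟩ˡ j)) (cong (lookup T) (inverseʳ π))) ⟩
    tabulate (lookup T)
      ≡⟨ tabulate∘lookup T ⟩
    T ∎

  imageFamily-cong : ∀ {𝓕 𝓖 : Subset m → Set} → (∀ S → 𝓕 S ⇔ 𝓖 S) →
                     ∀ T → imageFamily π 𝓕 T ⇔ imageFamily π 𝓖 T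
  imageFamily-cong 𝓕⇔𝓖 T = mk⇔
    (λ (S , S∈𝓕 , e) → S , to (𝓕⇔𝓖 S) S∈𝓕 , e)
    (λ (S , S∈𝓖 , e) → S , from (𝓕⇔𝓖 S) S∈𝓖 , e)

  imageFamily-onto : ∀ {𝓕 𝓖 : Subset m → Set} →
                     (∀ S → 𝓕 S → 𝓖 (permSubset π S)) →
                     (∀ T → 𝓖 T → 𝓕 (permSubset (flip π) T)) →
                     ∀ T → imageFamily π 𝓕 T ⇔ 𝓖 T
  imageFamily-onto into back T = mk⇔
    (λ { (S , S∈𝓕 , refl) → into S S∈𝓕 })
    (λ T∈𝓖 → permSubset (flip π) T , back T T∈𝓖 , permSubset-flip T)

-- the first index satisfying p (the last index if there is none)
firstIndex : ∀ {k} → (Fin (suc k) → Bool) → Fin (suc k)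
firstIndex {zero}  p = zero
firstIndex {suc k} p = if p zero then zero else suc (firstIndex (p ∘ suc))

-- the table of the inverse map, valid whenever f is a bijection
invert : ∀ {k} → Vec (Fin (suc k)) (suc k) → Vec (Fin (suc k)) (suc k)
invert f = tabulate λ i → firstIndex (λ j → ⌊ lookup f j ≟ᶠ i ⌋)

IsPermutationTable : ∀ {k} → Vec (Fin (suc k)) (suc k) → Set
IsPermutationTable f =
  (∀ i → lookup f (lookup (invert f) i) ≡ i) × (∀ i → lookup (invert f) (lookup f i) ≡ i)

isPermutationTable? : ∀ {k} (f : Vec (Fin (suc k)) (suc k)) → Dec (IsPermutationTable f)
isPermutationTable? f = all? (λ i → _ ≟ᶠ i) ×-dec all? (λ i → _ ≟ᶠ i)

fromTable : ∀ {k} (f : Vec (Fin (suc k)) (suc k)) → IsPermutationTable f → Permutation′ (suc k)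
fromTable f (f∘f⁻¹ , f⁻¹∘f) = permutation (lookup f) (lookup (invert f)) f∘f⁻¹ f⁻¹∘f

-- the image of S under the coordinate map with inverse table g
relabel : ∀ {k} → Vec (Fin (suc k)) (suc k) → Subset (suc k) → Subset (suc k)
relabel g S = tabulate (λ j → lookup S (lookup g j))

Aligns : ∀ {m} → Code m → F m → Permutation′ m → Set
Aligns {m} D w π = ∀ T → imageFamily π (STS D w) T ⇔ STS D (0ᵛ m) T

Certificate : ∀ {k} → Code (suc k) → F (suc k) → Vec (Fin (suc k)) (suc k) → Set
Certificate {k} D w f =
  IsPermutationTable f
  × (∀ S → STS D w S → STS D (0ᵛ (suc k)) (relabel (invert f) S))
  × (∀ T → STS D (0ᵛ (suc k)) T → STS D w (relabel f T))

certificate-aligns : ∀ {k} {D : Code (suc k)} {w} f →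
                     Certificate D w f → Σ (Permutation′ (suc k)) (Aligns D w)
certificate-aligns f (isPerm , into , back) =
  fromTable f isPerm , imageFamily-onto (fromTable f isPerm) into back

module _ {k} {D : Code (suc k)} {d : F (suc k) → Bool} (d-decides : Decides D d) where

  private
    0ᵏ : F (suc k)
    0ᵏ = 0ᵛ (suc k)

  into? back? : F (suc k) → Vec (Fin (suc k)) (suc k) → Subset (suc k) → Bool
  into? w f S = stsᵇ d-decides 0ᵏ (relabel (invert f) S)
  back? w f T = stsᵇ d-decides w (relabel f T)

  certificateᵇ : F (suc k) → Vec (Fin (suc k)) (suc k) → Bool
  certificateᵇ w f =
    ⌊ isPermutationTable? f ⌋ ∧ allSTS d-decides w (into? w f) ∧ allSTS d-decides 0ᵏ (back? w f)

  certificate-sound : ∀ w f → T (certificateᵇ w f) → Certificate D w f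
  certificate-sound w f t
    with isPerm , rest ← T-∧-elim ⌊ isPermutationTable? f ⌋ t
    with into , back ← T-∧-elim (allSTS d-decides w (into? w f)) rest =
    toWitness isPerm
    , (λ S S∈STS → to (sts-decides d-decides 0ᵏ (relabel (invert f) S))
                       (allSTS-sound d-decides w (into? w f) into S S∈STS))
    , (λ T T∈STS → to (sts-decides d-decides w (relabel f T))
                       (allSTS-sound d-decides 0ᵏ (back? w f) back T T∈STS))

  allCertifiedᵇ : (Bool → Bool → Bool → Bool → F (suc k)) →
                  (Bool → Bool → Bool → Bool → Vec (Fin (suc k)) (suc k)) → Bool
  allCertifiedᵇ w f = allBool⁴ λ c₁ c₂ c₃ c₄ → certificateᵇ (w c₁ c₂ c₃ c₄) (f c₁ c₂ c₃ c₄)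

  allCertified-sound : ∀ w f → T (allCertifiedᵇ w f) →
                       ∀ c₁ c₂ c₃ c₄ → Certificate D (w c₁ c₂ c₃ c₄) (f c₁ c₂ c₃ c₄)
  allCertified-sound w f t c₁ c₂ c₃ c₄ =
    certificate-sound (w c₁ c₂ c₃ c₄) (f c₁ c₂ c₃ c₄)
      (allBool⁴-sound (λ c₁ c₂ c₃ c₄ → certificateᵇ (w c₁ c₂ c₃ c₄) (f c₁ c₂ c₃ c₄))
                      t c₁ c₂ c₃ c₄)

module _ {n} (H : Code n) (λf : F n → Bool) where

  private
    D : Code (n + suc n)
    D = Vasilev H λf

  codeword : F n → F n → F (n + suc n)
  codeword x y = (x ⊕ y) ++ ((parity x xor λf y) ∷ x)

  shift : F n → F (n + suc n)
  shift z = z ++ (parity z ∷ z)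

  codeword-shift : ∀ x y z → codeword x y ⊕ shift z ≡ codeword (x ⊕ z) y
  codeword-shift x y z = begin
    codeword x y ⊕ shift z
      ≡⟨ zipWith-++ _xor_ (x ⊕ y) _ z _ ⟩
    ((x ⊕ y) ⊕ z) ++ (((parity x xor λf y) xor parity z) ∷ (x ⊕ z))
      ≡⟨ cong₂ (λ u b → u ++ (b ∷ (x ⊕ z))) (⊕-swap x y z) parity-step ⟩
    codeword (x ⊕ z) y ∎
    where
      parity-step : (parity x xor λf y) xor parity z ≡ parity (x ⊕ z) xor λf y
      parity-step = trans (xy∙z≈xz∙y (parity x) (λf y) (parity z))
                          (cong (_xor λf y) (sym (parity-⊕ x z)))

  Vasilev-shift : ∀ z v → D v → D (v ⊕ shift z)
  Vasilev-shift z _ (x , y , y∈H , refl) = x ⊕ z , y , y∈H , codeword-shift x y z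

  leader : F n → F (n + suc n)
  leader y = codeword (0ᵛ n) y

  codeword-leader : ∀ x y → codeword x y ⊕ shift x ≡ leader y
  codeword-leader x y = trans (codeword-shift x y x) (cong (λ u → codeword u y) (⊕-self x))

  Vasilev-homogeneous : (∀ y → H y → Σ (Permutation′ (n + suc n)) (Aligns D (leader y))) →
                        Homogeneous D
  Vasilev-homogeneous align _ (x , y , y∈H , refl)
    with π , aligned ← align y y∈H =
    π , λ T → ⇔-trans (⇔-sym (imageFamily-cong π leader≡codeword T)) (aligned T)
    where
      leader≡codeword : ∀ S → STS D (leader y) S ⇔ STS D (codeword x y) S
      leader≡codeword S = subst (λ w → STS D w S ⇔ STS D (codeword x y) S)
                                (codeword-leader x y)
                                (STS-translate D (shift x) (Vasilev-shift x) (codeword x y) S)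

  -- a word (a, p, b) can only be the codeword with x = b and y = a + b
  readX readY : F (n + suc n) → F n
  readX v = tail (drop n v)
  readY v = take n v ⊕ readX v

  codeword-parts : ∀ x y → readX (codeword x y) ≡ x × readY (codeword x y) ≡ y
  codeword-parts x y = x≡ , (begin
    take n (codeword x y) ⊕ readX (codeword x y)  ≡⟨ cong₂ _⊕_ (proj₁ halves) x≡ ⟩
    (x ⊕ y) ⊕ x                                   ≡⟨ cong (_⊕ x) (⊕-comm x y) ⟩
    (y ⊕ x) ⊕ x                                   ≡⟨ ⊕-cancelʳ y x ⟩
    y                                             ∎)
    where
      halves : take n (codeword x y) ≡ x ⊕ y × drop n (codeword x y) ≡ (parity x xor λf y) ∷ x
      halves = split-++ (x ⊕ y) ((parity x xor λf y) ∷ x)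
      x≡ : readX (codeword x y) ≡ x
      x≡ = cong tail (proj₂ halves)

  vasilevᵇ : (F n → Bool) → F (n + suc n) → Bool
  vasilevᵇ h v = h (readY v) ∧ eqᵇ v (codeword (readX v) (readY v))

  vasilev-decides : ∀ {h} → Decides H h → Decides D (vasilevᵇ h)
  vasilev-decides {h} h-decides v = mk⇔ sound complete
    where
      sound : T (vasilevᵇ h v) → D v
      sound t with y∈H , v≡ ← T-∧-elim (h (readY v)) t =
        readX v , readY v , to (h-decides _) y∈H , eqᵇ-sound v _ v≡
      complete : D v → T (vasilevᵇ h v)
      complete (x , y , y∈H , refl) =
        from T-∧ (subst₂ (λ x′ y′ → T (h y′) × T (eqᵇ (codeword x y) (codeword x′ y′)))
                         (sym (proj₁ (codeword-parts x y))) (sym (proj₂ (codeword-parts x y)))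
                         (from (h-decides y) y∈H , eqᵇ-refl (codeword x y)))

hammingWord : Bool → Bool → Bool → Bool → F 7
hammingWord c₁ c₂ c₃ c₄ = (c₁ · g₁) ⊕ (c₂ · g₂) ⊕ (c₃ · g₃) ⊕ (c₄ · g₄)

-- a word of H is determined by its coordinates 3, 5, 7 and the sum of 4 and 5
hammingᵇ : F 7 → Bool
hammingᵇ y@(_ ∷ _ ∷ y₃ ∷ y₄ ∷ y₅ ∷ _ ∷ y₇ ∷ []) = eqᵇ y (hammingWord y₃ y₅ y₇ (y₄ xor y₅))

hamming-decides : Decides Hamming hammingᵇ
hamming-decides y = mk⇔ (sound y) (λ { (c₁ , c₂ , c₃ , c₄ , refl) → complete c₁ c₂ c₃ c₄ })
  where
    sound : ∀ y → T (hammingᵇ y) → Hamming y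
    sound y@(_ ∷ _ ∷ y₃ ∷ y₄ ∷ y₅ ∷ _ ∷ y₇ ∷ []) t = y₃ , y₅ , y₇ , y₄ xor y₅ , eqᵇ-sound y _ t
    complete : ∀ c₁ c₂ c₃ c₄ → T (hammingᵇ (hammingWord c₁ c₂ c₃ c₄))
    complete = allBool⁴-sound (λ c₁ c₂ c₃ c₄ → hammingᵇ (hammingWord c₁ c₂ c₃ c₄)) _

Tables : Set
Tables = Bool → Bool → Bool → Bool → Vec (Fin 15) 15

module _ (λf : F 7 → Bool) where

  private
    decides : Decides (Vasilev Hamming λf) (vasilevᵇ Hamming λf hammingᵇ)
    decides = vasilev-decides Hamming λf hamming-decides

    leaderOf : Bool → Bool → Bool → Bool → F 15
    leaderOf c₁ c₂ c₃ c₄ = leader Hamming λf (hammingWord c₁ c₂ c₃ c₄)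

  homogeneous-by-tables : ∀ table → T (allCertifiedᵇ decides leaderOf table) →
                          Homogeneous (Vasilev Hamming λf)
  homogeneous-by-tables table certified =
    Vasilev-homogeneous Hamming λf λ { _ (c₁ , c₂ , c₃ , c₄ , refl) →
      certificate-aligns (table c₁ c₂ c₃ c₄)
        (allCertified-sound decides leaderOf table certified c₁ c₂ c₃ c₄) }

-- each table lists the images π(0), …, π(14) of the coordinates (numbered from 0)
table₁ : Tables
table₁ false false false false = # 0 ∷ # 1 ∷ # 2 ∷ # 3 ∷ # 4 ∷ # 5 ∷ # 6 ∷ # 7 ∷ # 8 ∷ # 9 ∷ # 10 ∷ # 11 ∷ # 12 ∷ # 13 ∷ # 14 ∷ []
table₁ false false false true  = # 1 ∷ # 0 ∷ # 10 ∷ # 5 ∷ # 11 ∷ # 14 ∷ # 4 ∷ # 7 ∷ # 9 ∷ # 8 ∷ # 2 ∷ # 13 ∷ # 3 ∷ # 6 ∷ # 12 ∷ []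
table₁ false false true  false = # 1 ∷ # 0 ∷ # 2 ∷ # 5 ∷ # 3 ∷ # 14 ∷ # 4 ∷ # 7 ∷ # 9 ∷ # 8 ∷ # 10 ∷ # 13 ∷ # 11 ∷ # 6 ∷ # 12 ∷ []
table₁ false false true  true  = # 0 ∷ # 1 ∷ # 10 ∷ # 3 ∷ # 12 ∷ # 5 ∷ # 6 ∷ # 7 ∷ # 8 ∷ # 9 ∷ # 2 ∷ # 11 ∷ # 4 ∷ # 13 ∷ # 14 ∷ []
table₁ false true  false false = # 1 ∷ # 0 ∷ # 10 ∷ # 5 ∷ # 3 ∷ # 6 ∷ # 12 ∷ # 7 ∷ # 9 ∷ # 8 ∷ # 2 ∷ # 13 ∷ # 11 ∷ # 14 ∷ # 4 ∷ []
table₁ false true  false true  = # 0 ∷ # 1 ∷ # 10 ∷ # 3 ∷ # 12 ∷ # 13 ∷ # 14 ∷ # 7 ∷ # 8 ∷ # 9 ∷ # 2 ∷ # 11 ∷ # 4 ∷ # 5 ∷ # 6 ∷ []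
table₁ false true  true  false = # 0 ∷ # 1 ∷ # 2 ∷ # 3 ∷ # 4 ∷ # 13 ∷ # 14 ∷ # 7 ∷ # 8 ∷ # 9 ∷ # 10 ∷ # 11 ∷ # 12 ∷ # 5 ∷ # 6 ∷ []
table₁ false true  true  true  = # 1 ∷ # 0 ∷ # 2 ∷ # 5 ∷ # 11 ∷ # 6 ∷ # 12 ∷ # 7 ∷ # 9 ∷ # 8 ∷ # 10 ∷ # 13 ∷ # 3 ∷ # 14 ∷ # 4 ∷ []
table₁ true  false false false = # 1 ∷ # 0 ∷ # 2 ∷ # 5 ∷ # 11 ∷ # 6 ∷ # 12 ∷ # 7 ∷ # 9 ∷ # 8 ∷ # 10 ∷ # 13 ∷ # 3 ∷ # 14 ∷ # 4 ∷ []
table₁ true  false false true  = # 0 ∷ # 1 ∷ # 10 ∷ # 3 ∷ # 12 ∷ # 13 ∷ # 14 ∷ # 7 ∷ # 8 ∷ # 9 ∷ # 2 ∷ # 11 ∷ # 4 ∷ # 5 ∷ # 6 ∷ []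
table₁ true  false true  false = # 0 ∷ # 1 ∷ # 2 ∷ # 3 ∷ # 4 ∷ # 13 ∷ # 14 ∷ # 7 ∷ # 8 ∷ # 9 ∷ # 10 ∷ # 11 ∷ # 12 ∷ # 5 ∷ # 6 ∷ []
table₁ true  false true  true  = # 1 ∷ # 0 ∷ # 10 ∷ # 5 ∷ # 3 ∷ # 6 ∷ # 12 ∷ # 7 ∷ # 9 ∷ # 8 ∷ # 2 ∷ # 13 ∷ # 11 ∷ # 14 ∷ # 4 ∷ []
table₁ true  true  false false = # 0 ∷ # 1 ∷ # 10 ∷ # 3 ∷ # 12 ∷ # 13 ∷ # 6 ∷ # 7 ∷ # 8 ∷ # 9 ∷ # 2 ∷ # 11 ∷ # 4 ∷ # 5 ∷ # 14 ∷ []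
table₁ true  true  false true  = # 1 ∷ # 0 ∷ # 10 ∷ # 5 ∷ # 11 ∷ # 6 ∷ # 4 ∷ # 7 ∷ # 9 ∷ # 8 ∷ # 2 ∷ # 13 ∷ # 3 ∷ # 14 ∷ # 12 ∷ []
table₁ true  true  true  false = # 1 ∷ # 0 ∷ # 2 ∷ # 5 ∷ # 3 ∷ # 6 ∷ # 4 ∷ # 7 ∷ # 9 ∷ # 8 ∷ # 10 ∷ # 13 ∷ # 11 ∷ # 14 ∷ # 12 ∷ []
table₁ true  true  true  true  = # 0 ∷ # 1 ∷ # 2 ∷ # 3 ∷ # 4 ∷ # 13 ∷ # 6 ∷ # 7 ∷ # 8 ∷ # 9 ∷ # 10 ∷ # 11 ∷ # 12 ∷ # 5 ∷ # 14 ∷ []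

table₂ : Tables
table₂ false false false false = # 0 ∷ # 1 ∷ # 2 ∷ # 3 ∷ # 4 ∷ # 5 ∷ # 6 ∷ # 7 ∷ # 8 ∷ # 9 ∷ # 10 ∷ # 11 ∷ # 12 ∷ # 13 ∷ # 14 ∷ []
table₂ false false false true  = # 2 ∷ # 4 ∷ # 5 ∷ # 0 ∷ # 1 ∷ # 11 ∷ # 14 ∷ # 7 ∷ # 10 ∷ # 12 ∷ # 13 ∷ # 8 ∷ # 9 ∷ # 3 ∷ # 6 ∷ []
table₂ false false true  false = # 2 ∷ # 4 ∷ # 5 ∷ # 0 ∷ # 9 ∷ # 3 ∷ # 14 ∷ # 7 ∷ # 10 ∷ # 12 ∷ # 13 ∷ # 8 ∷ # 1 ∷ # 11 ∷ # 6 ∷ []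
table₂ false false true  true  = # 0 ∷ # 1 ∷ # 10 ∷ # 3 ∷ # 12 ∷ # 13 ∷ # 6 ∷ # 7 ∷ # 8 ∷ # 9 ∷ # 2 ∷ # 11 ∷ # 4 ∷ # 5 ∷ # 14 ∷ []
table₂ false true  false false = # 2 ∷ # 4 ∷ # 13 ∷ # 0 ∷ # 1 ∷ # 11 ∷ # 14 ∷ # 7 ∷ # 10 ∷ # 12 ∷ # 5 ∷ # 8 ∷ # 9 ∷ # 3 ∷ # 6 ∷ []
table₂ false true  false true  = # 0 ∷ # 1 ∷ # 10 ∷ # 3 ∷ # 4 ∷ # 5 ∷ # 6 ∷ # 7 ∷ # 8 ∷ # 9 ∷ # 2 ∷ # 11 ∷ # 12 ∷ # 13 ∷ # 14 ∷ []
table₂ false true  true  false = # 0 ∷ # 1 ∷ # 2 ∷ # 3 ∷ # 12 ∷ # 13 ∷ # 6 ∷ # 7 ∷ # 8 ∷ # 9 ∷ # 10 ∷ # 11 ∷ # 4 ∷ # 5 ∷ # 14 ∷ []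
table₂ false true  true  true  = # 2 ∷ # 4 ∷ # 13 ∷ # 0 ∷ # 9 ∷ # 3 ∷ # 14 ∷ # 7 ∷ # 10 ∷ # 12 ∷ # 5 ∷ # 8 ∷ # 1 ∷ # 11 ∷ # 6 ∷ []
table₂ true  false false false = # 2 ∷ # 4 ∷ # 5 ∷ # 0 ∷ # 9 ∷ # 11 ∷ # 6 ∷ # 7 ∷ # 10 ∷ # 12 ∷ # 13 ∷ # 8 ∷ # 1 ∷ # 3 ∷ # 14 ∷ []
table₂ true  false false true  = # 0 ∷ # 1 ∷ # 2 ∷ # 3 ∷ # 12 ∷ # 5 ∷ # 6 ∷ # 7 ∷ # 8 ∷ # 9 ∷ # 10 ∷ # 11 ∷ # 4 ∷ # 13 ∷ # 14 ∷ []
table₂ true  false true  false = # 0 ∷ # 1 ∷ # 2 ∷ # 3 ∷ # 12 ∷ # 5 ∷ # 6 ∷ # 7 ∷ # 8 ∷ # 9 ∷ # 10 ∷ # 11 ∷ # 4 ∷ # 13 ∷ # 14 ∷ []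
table₂ true  false true  true  = # 2 ∷ # 4 ∷ # 13 ∷ # 0 ∷ # 9 ∷ # 11 ∷ # 6 ∷ # 7 ∷ # 10 ∷ # 12 ∷ # 5 ∷ # 8 ∷ # 1 ∷ # 3 ∷ # 14 ∷ []
table₂ true  true  false false = # 0 ∷ # 1 ∷ # 10 ∷ # 3 ∷ # 12 ∷ # 5 ∷ # 6 ∷ # 7 ∷ # 8 ∷ # 9 ∷ # 2 ∷ # 11 ∷ # 4 ∷ # 13 ∷ # 14 ∷ []
table₂ true  true  false true  = # 2 ∷ # 4 ∷ # 13 ∷ # 0 ∷ # 9 ∷ # 11 ∷ # 6 ∷ # 7 ∷ # 10 ∷ # 12 ∷ # 5 ∷ # 8 ∷ # 1 ∷ # 3 ∷ # 14 ∷ []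
table₂ true  true  true  false = # 2 ∷ # 4 ∷ # 5 ∷ # 0 ∷ # 9 ∷ # 11 ∷ # 6 ∷ # 7 ∷ # 10 ∷ # 12 ∷ # 13 ∷ # 8 ∷ # 1 ∷ # 3 ∷ # 14 ∷ []
table₂ true  true  true  true  = # 0 ∷ # 1 ∷ # 10 ∷ # 3 ∷ # 12 ∷ # 5 ∷ # 6 ∷ # 7 ∷ # 8 ∷ # 9 ∷ # 2 ∷ # 11 ∷ # 4 ∷ # 13 ∷ # 14 ∷ []
mainTheorem7 : Homogeneous V22¹ × Homogeneous V3¹¹
mainTheorem7 = homogeneous-by-tables λ₁ table₁ _ , homogeneous-by-tables λ₂ table₂ _
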